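{- For all integers $k\ge 0$ and $n\ge k+2$, $$\sum_{l=0}^k\left\{{n-1\atop n-l-1}\right\}_{n-k-1}c_{n-l}^{(-k)}=0.$$
   Context: For an integer $k$, the poly-Cauchy numbers $c_n^{(k)}$ are defined by $\mathrm{Lif}_k(\log(1+x))=\sum_{n\ge0}c_n^{(k)}x^n/n!$, where $\mathrm{Lif}_k(z)=\sum_{m\ge0}\frac{z^m}{m!(m+1)^k}$; thus $c_n^{(-k)}$ uses $\mathrm{Lif}_{ -k}(z)=\sum_{m\ge0}\frac{(m+1)^k z^m}{m!}$. For $r\ge 0$, the $r$-Stirling number of the second kind $\left\{{n\atop m}\right\}_r$ is the number of ways to partition $\{1,\dots,n\}$ into $m$ nonempty disjoint blocks such that $1,\dots,r$ lie in distinct blocks; equivalently $\left\{{n\atop m}\right\}_r=0$ for $n<r$, $\left\{{r\atop m}\right\}_r=\delta_{m,r}$, and $\left\{{n\atop m}\right\}_r=m\left\{{n-1\atop m}\right\}_r+\left\{{n-1\atop m-1}\right\}_r$ for $n>r$. -}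

module Defs where

open import Data.Nat as ℕ using (ℕ; zero; suc; _<ᵇ_; _≡ᵇ_)
open import Data.Bool using (Bool; true; false; if_then_else_)
open import Data.Integer as ℤ using (ℤ; +_; _-_; _*_; _+_)

sumTo : ℕ → (ℕ → ℤ) → ℤ
sumTo zero    f = f zero
sumTo (suc k) f = sumTo k f + f (suc k)

-- Signed Stirling numbers of the first kind s(n,m):
-- (log(1+x))^m / m! = Σ_n s(n,m) x^n/n!,  s(n+1,m+1) = s(n,m) - n s(n,m+1).
stirling1 : ℕ → ℕ → ℤ
stirling1 zero    zero    = + 1
stirling1 zero    (suc m) = + 0
stirling1 (suc n) zero    = + 0
stirling1 (suc n) (suc m) = stirling1 n m - (+ n) * stirling1 n (suc m)

-- Poly-Cauchy number c_n^{(-k)} = n! [x^n] Lif_{-k}(log(1+x))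
--   = Σ_{m=0}^n s(n,m) (m+1)^k   (coefficient extraction of the composition).
polyCauchyNeg : ℕ → ℕ → ℤ
polyCauchyNeg n k = sumTo n (λ m → stirling1 n m * (+ (suc m ℕ.^ k)))

-- r-Stirling numbers of the second kind {n over m}_r, by the recurrence of the paper:
-- 0 for n < r, δ_{m,r} for n = r, m{n-1,m}_r + {n-1,m-1}_r for n > r
-- (with {.,-1}_r = 0).
δ : ℕ → ℕ → ℕ
δ a b = if a ≡ᵇ b then 1 else 0

rStirling2 : ℕ → ℕ → ℕ → ℕ
rStirling2 r zero m = δ r 0 ℕ.* δ m 0
rStirling2 r (suc n) m =
  if suc n <ᵇ r then 0
  else if suc n ≡ᵇ r then δ m r
  else step m
  where
    step : ℕ → ℕ
    step zero    = 0
    step (suc j) = suc j ℕ.* rStirling2 r n (suc j) ℕ.+ rStirling2 r n j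

-- Let E be the shift and Δ = E - 1 the forward difference on sequences ℕ → ℤ,
-- and (Δ)ⱼ = Δ(Δ - 1)⋯(Δ - j + 1).  Expanding Lif₋ₖ(log(1 + x)) gives
-- c_n^(-k) = Σₘ s(n,m) (m+1)^k, and Σₘ s(n+1,m) Eᵐ = E(E - 1)⋯(E - n) = (Δ)ₙ E, so
-- c_(m+1)^(-k) = ((Δ)ₘ g)(0) with g(p) = (p+2)^k.  The r-Stirling numbers expand
-- Δ^(N-r) (Δ)ᵣ = Σₘ {N,m}ᵣ (Δ)ₘ; with N = n - 1 and r = n - k - 1 the sum of the
-- theorem becomes (Δᵏ (Δ)ᵣ g)(0).  As r ≥ 1, (Δ)ᵣ contains a factor Δ, and Δ^(k+1)
-- annihilates the polynomial g of degree k.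
module Submission where

open import Defs
open import Data.Nat using (ℕ; zero; suc; _+_; _∸_; _≤_; _<_; z≤n; s≤s; _<ᵇ_; _≡ᵇ_)
import Data.Nat as ℕ
import Data.Nat.Properties as ℕ
open import Data.Nat.Properties
  using (≤-refl; ≤-trans; <-trans; <-cmp; n<1+n; m<n⇒m<1+n; m≤n⇒m≤1+n; m≤m+n; m≤n+m;
         <⇒≢; >⇒≢; +-suc; +-∸-assoc; +-∸-comm; n∸n≡0; m+n∸m≡n; m≤n⇒∃[o]m+o≡n)
open import Data.Integer using (ℤ; +_; _*_; _-_; -_; 0ℤ; 1ℤ)
import Data.Integer as ℤ
import Data.Integer.Properties as ℤP
open import Data.Integer.Tactic.RingSolver using (solve-∀)
open import Algebra.Properties.CommutativeSemigroup ℤP.+-commutativeSemigroup using (interchange)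
open import Data.Bool using (true; false)
open import Data.Empty using (⊥-elim)
open import Data.Product using (_,_)
open import Relation.Binary.Definitions using (tri<; tri≈; tri>)
open import Relation.Binary.PropositionalEquality
  using (_≡_; _≢_; _≗_; refl; sym; trans; cong; cong₂; module ≡-Reasoning)
open ≡-Reasoning

-- Finite sums

sumTo-cong : ∀ k {f g : ℕ → ℤ} → (∀ i → i ≤ k → f i ≡ g i) → sumTo k f ≡ sumTo k g
sumTo-cong zero    f≡g = f≡g 0 z≤n
sumTo-cong (suc k) f≡g =
  cong₂ ℤ._+_ (sumTo-cong k (λ i i≤k → f≡g i (m≤n⇒m≤1+n i≤k))) (f≡g (suc k) ≤-refl)

sumTo-+ : ∀ k (f g : ℕ → ℤ) → sumTo k (λ i → f i ℤ.+ g i) ≡ sumTo k f ℤ.+ sumTo k g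
sumTo-+ zero    f g = refl
sumTo-+ (suc k) f g =
  trans (cong (ℤ._+ (f (suc k) ℤ.+ g (suc k))) (sumTo-+ k f g))
        (interchange (sumTo k f) (sumTo k g) (f (suc k)) (g (suc k)))

sumTo-neg : ∀ k (f : ℕ → ℤ) → sumTo k (λ i → - f i) ≡ - sumTo k f
sumTo-neg zero    f = refl
sumTo-neg (suc k) f =
  trans (cong (ℤ._+ - f (suc k)) (sumTo-neg k f)) (sym (ℤP.neg-distrib-+ (sumTo k f) (f (suc k))))

sumTo-- : ∀ k (f g : ℕ → ℤ) → sumTo k (λ i → f i - g i) ≡ sumTo k f - sumTo k g
sumTo-- k f g = trans (sumTo-+ k f (λ i → - g i)) (cong (ℤ._+_ (sumTo k f)) (sumTo-neg k g))

sumTo-*ˡ : ∀ k c (f : ℕ → ℤ) → sumTo k (λ i → c * f i) ≡ c * sumTo k f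
sumTo-*ˡ zero    c f = refl
sumTo-*ˡ (suc k) c f =
  trans (cong (ℤ._+ c * f (suc k)) (sumTo-*ˡ k c f)) (sym (ℤP.*-distribˡ-+ c _ _))

sumTo-shift : ∀ k (f : ℕ → ℤ) → sumTo (suc k) f ≡ f 0 ℤ.+ sumTo k (λ i → f (suc i))
sumTo-shift zero    f = refl
sumTo-shift (suc k) f =
  trans (cong (ℤ._+ f (suc (suc k))) (sumTo-shift k f))
        (ℤP.+-assoc (f 0) (sumTo k (λ i → f (suc i))) (f (suc (suc k))))

sumTo-shift-vanishing : ∀ k (f : ℕ → ℤ) → f 0 ≡ 0ℤ → f (suc k) ≡ 0ℤ →
  sumTo k (λ i → f (suc i)) ≡ sumTo k f
sumTo-shift-vanishing k f f0≡0 fk≡0 = begin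
  sumTo k (λ i → f (suc i))           ≡⟨ ℤP.+-identityˡ _ ⟨
  0ℤ ℤ.+ sumTo k (λ i → f (suc i))    ≡⟨ cong (ℤ._+ sumTo k (λ i → f (suc i))) f0≡0 ⟨
  f 0 ℤ.+ sumTo k (λ i → f (suc i))   ≡⟨ sumTo-shift k f ⟨
  sumTo k f ℤ.+ f (suc k)             ≡⟨ cong (ℤ._+_ (sumTo k f)) fk≡0 ⟩
  sumTo k f ℤ.+ 0ℤ                    ≡⟨ ℤP.+-identityʳ (sumTo k f) ⟩
  sumTo k f                           ∎

sumTo-last : ∀ k {f : ℕ → ℤ} → (∀ i → i < k → f i ≡ 0ℤ) → sumTo k f ≡ f k
sumTo-last zero    _     = refl
sumTo-last (suc k) {f} f≡0 = trans (cong (ℤ._+ f (suc k)) sumTo-k≡0) (ℤP.+-identityˡ (f (suc k)))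
  where
    sumTo-k≡0 : sumTo k f ≡ 0ℤ
    sumTo-k≡0 = trans (sumTo-last k (λ i i<k → f≡0 i (m<n⇒m<1+n i<k))) (f≡0 k (n<1+n k))

sumTo-drop : ∀ j r {f : ℕ → ℤ} → (∀ i → i < r → f i ≡ 0ℤ) →
  sumTo (j + r) f ≡ sumTo j (λ i → f (i + r))
sumTo-drop zero    r     f≡0 = sumTo-last r f≡0
sumTo-drop (suc j) r {f} f≡0 = cong (ℤ._+ f (suc j + r)) (sumTo-drop j r f≡0)

sumTo-reverse : ∀ k (f : ℕ → ℤ) → sumTo k (λ l → f (k ∸ l)) ≡ sumTo k f
sumTo-reverse zero    f = refl
sumTo-reverse (suc k) f = begin
  sumTo k (λ l → f (suc k ∸ l)) ℤ.+ f (k ∸ k)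
    ≡⟨ cong₂ ℤ._+_ (sumTo-cong k (λ l l≤k → cong f (+-∸-assoc 1 l≤k))) (cong f (n∸n≡0 k)) ⟩
  sumTo k (λ l → f (suc (k ∸ l))) ℤ.+ f 0
    ≡⟨ cong (ℤ._+ f 0) (sumTo-reverse k (λ i → f (suc i))) ⟩
  sumTo k (λ i → f (suc i)) ℤ.+ f 0
    ≡⟨ ℤP.+-comm _ (f 0) ⟩
  f 0 ℤ.+ sumTo k (λ i → f (suc i))
    ≡⟨ sumTo-shift k f ⟨
  sumTo (suc k) f ∎

sumTo-reverse-drop : ∀ k r {f : ℕ → ℤ} → (∀ i → i < r → f i ≡ 0ℤ) →
  sumTo k (λ l → f (k + r ∸ l)) ≡ sumTo (k + r) f
sumTo-reverse-drop k r {f} f≡0 = begin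
  sumTo k (λ l → f (k + r ∸ l))   ≡⟨ sumTo-cong k (λ l l≤k → cong f (+-∸-comm r l≤k)) ⟩
  sumTo k (λ l → f (k ∸ l + r))   ≡⟨ sumTo-reverse k (λ i → f (i + r)) ⟩
  sumTo k (λ i → f (i + r))       ≡⟨ sumTo-drop k r f≡0 ⟨
  sumTo (k + r) f                 ∎

-- The difference calculus on integer sequences

Seq : Set
Seq = ℕ → ℤ

shift : Seq → Seq
shift f p = f (suc p)

Δ : Seq → Seq
Δ f p = f (suc p) - f p

Δ^ : ℕ → Seq → Seq
Δ^ zero    f = f
Δ^ (suc d) f = Δ^ d (Δ f)

falling : ℕ → Seq → Seq
falling zero    f   = f
falling (suc j) f p = Δ (falling j f) p - + j * falling j f p

Δ-+ : ∀ (f g : Seq) p → Δ (λ q → f q ℤ.+ g q) p ≡ Δ f p ℤ.+ Δ g p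
Δ-+ f g p = regroup (f (suc p)) (g (suc p)) (f p) (g p)
  where
    regroup : ∀ a b c d → (a ℤ.+ b) - (c ℤ.+ d) ≡ (a - c) ℤ.+ (b - d)
    regroup = solve-∀

Δ-*ˡ : ∀ c (f : Seq) p → Δ (λ q → c * f q) p ≡ c * Δ f p
Δ-*ˡ c f p = factor c (f (suc p)) (f p)
  where
    factor : ∀ c a b → c * a - c * b ≡ c * (a - b)
    factor = solve-∀

Δ-sumTo : ∀ k (c : ℕ → ℤ) (a : ℕ → Seq) p →
  Δ (λ q → sumTo k (λ m → c m * a m q)) p ≡ sumTo k (λ m → c m * Δ (a m) p)
Δ-sumTo k c a p = trans (sym (sumTo-- k _ _)) (sumTo-cong k (λ m _ → Δ-*ˡ (c m) (a m) p))

Δ^-Δ : ∀ d (f : Seq) → Δ^ d (Δ f) ≗ Δ (Δ^ d f)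
Δ^-Δ zero    f p = refl
Δ^-Δ (suc d) f   = Δ^-Δ d (Δ f)

falling-shift : ∀ j (f : Seq) p → falling j (shift f) p ≡ falling j f (suc p)
falling-shift zero    f p = refl
falling-shift (suc j) f p rewrite falling-shift j f (suc p) | falling-shift j f p = refl

Δ-falling : ∀ j (f : Seq) p → Δ (falling j f) p ≡ falling (suc j) f p ℤ.+ + j * falling j f p
Δ-falling j f p = add-back (Δ (falling j f) p) (+ j * falling j f p)
  where
    add-back : ∀ a b → a ≡ (a - b) ℤ.+ b
    add-back = solve-∀

Δ-*affine : ∀ c (g : Seq) p → Δ (λ m → + (c + m) * g m) p ≡ + (suc c + p) * Δ g p ℤ.+ g p
Δ-*affine c g p rewrite +-suc c p = product-rule (+ (c + p)) (g (suc p)) (g p)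
  where
    product-rule : ∀ x a b → (1ℤ ℤ.+ x) * a - x * b ≡ (1ℤ ℤ.+ x) * (a - b) ℤ.+ b
    product-rule = solve-∀

-- Polynomial sequences

data DegreeBelow : ℕ → Seq → Set where
  vanishing : ∀ {f} → (∀ p → f p ≡ 0ℤ) → DegreeBelow zero f
  Δ-degree  : ∀ {d f} → DegreeBelow d (Δ f) → DegreeBelow (suc d) f

DegreeBelow-Δ^ : ∀ {d f} → DegreeBelow d f → ∀ p → Δ^ d f p ≡ 0ℤ
DegreeBelow-Δ^ (vanishing f≡0) = f≡0
DegreeBelow-Δ^ (Δ-degree Δf<d) = DegreeBelow-Δ^ Δf<d

DegreeBelow-cong : ∀ {d} {f g : Seq} → f ≗ g → DegreeBelow d f → DegreeBelow d g
DegreeBelow-cong f≗g (vanishing f≡0) = vanishing (λ p → trans (sym (f≗g p)) (f≡0 p))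
DegreeBelow-cong f≗g (Δ-degree Δf<d) =
  Δ-degree (DegreeBelow-cong (λ p → cong₂ _-_ (f≗g (suc p)) (f≗g p)) Δf<d)

DegreeBelow-+ : ∀ {d} {f g : Seq} → DegreeBelow d f → DegreeBelow d g →
  DegreeBelow d (λ p → f p ℤ.+ g p)
DegreeBelow-+ (vanishing f≡0) (vanishing g≡0) = vanishing (λ p → cong₂ ℤ._+_ (f≡0 p) (g≡0 p))
DegreeBelow-+ {f = f} {g} (Δ-degree Δf<d) (Δ-degree Δg<d) =
  Δ-degree (DegreeBelow-cong (λ p → sym (Δ-+ f g p)) (DegreeBelow-+ Δf<d Δg<d))

DegreeBelow-*ˡ : ∀ {d} c {f : Seq} → DegreeBelow d f → DegreeBelow d (λ p → c * f p)
DegreeBelow-*ˡ c (vanishing f≡0) = vanishing (λ p → trans (cong (c *_) (f≡0 p)) (ℤP.*-zeroʳ c))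
DegreeBelow-*ˡ c {f} (Δ-degree Δf<d) =
  Δ-degree (DegreeBelow-cong (λ p → sym (Δ-*ˡ c f p)) (DegreeBelow-*ˡ c Δf<d))

DegreeBelow-Δ : ∀ {d} {f : Seq} → DegreeBelow d f → DegreeBelow d (Δ f)
DegreeBelow-Δ (vanishing f≡0) = vanishing (λ p → cong₂ _-_ (f≡0 (suc p)) (f≡0 p))
DegreeBelow-Δ (Δ-degree Δf<d) = Δ-degree (DegreeBelow-Δ Δf<d)

DegreeBelow-*affine : ∀ {d} c {g : Seq} → DegreeBelow d g → DegreeBelow (suc d) (λ m → + (c + m) * g m)
DegreeBelow-*affine c {g} (vanishing g≡0) = Δ-degree (vanishing (λ p →
  trans (cong₂ (λ a b → + (c + suc p) * a - + (c + p) * b) (g≡0 (suc p)) (g≡0 p))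
        (cong₂ _-_ (ℤP.*-zeroʳ (+ (c + suc p))) (ℤP.*-zeroʳ (+ (c + p))))))
DegreeBelow-*affine c {g} g<d+1@(Δ-degree Δg<d) = Δ-degree
  (DegreeBelow-cong (λ p → sym (Δ-*affine c g p)) (DegreeBelow-+ (DegreeBelow-*affine (suc c) Δg<d) g<d+1))

DegreeBelow-^ : ∀ k c → DegreeBelow (suc k) (λ m → + (c + m) ℕ.^ k)
DegreeBelow-^ zero    c = Δ-degree (vanishing (λ p → refl))
DegreeBelow-^ (suc k) c =
  DegreeBelow-cong (λ m → sym (ℤP.pos-* (c + m) ((c + m) ℕ.^ k)))
    (DegreeBelow-*affine c (DegreeBelow-^ k c))

DegreeBelow-falling : ∀ {d} {g : Seq} → DegreeBelow (suc d) g → ∀ j → DegreeBelow d (falling (suc j) g)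
DegreeBelow-falling {g = g} (Δ-degree Δg<d) zero =
  DegreeBelow-cong (λ p → sym (ℤP.+-identityʳ (Δ g p))) Δg<d
DegreeBelow-falling {d} {g} g<d+1 (suc j) =
  DegreeBelow-cong (λ p → cong (ℤ._+_ (Δ h p)) (sym (ℤP.neg-distribˡ-* (+ suc j) (h p))))
    (DegreeBelow-+ (DegreeBelow-Δ h<d) (DegreeBelow-*ˡ (- + suc j) h<d))
  where
    h : Seq
    h = falling (suc j) g
    h<d : DegreeBelow d h
    h<d = DegreeBelow-falling g<d+1 j

-- Stirling numbers

stirling1-above : ∀ {n m} → n < m → stirling1 n m ≡ 0ℤ
stirling1-above {zero}  {suc m} _ = refl
stirling1-above {suc n} {suc m} (s≤s n<m) =
  trans (cong₂ (λ a b → a - + n * b) (stirling1-above n<m) (stirling1-above (m<n⇒m<1+n n<m)))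
        (cong (_-_ 0ℤ) (ℤP.*-zeroʳ (+ n)))

-- The factor n takes care of n = 0, where s(0,0) = 1 does not vanish.
sumTo-stirling1-shift : ∀ n (f : Seq) →
  + n * sumTo n (λ m → stirling1 n (suc m) * f (suc m)) ≡ + n * sumTo n (λ m → stirling1 n m * f m)
sumTo-stirling1-shift zero    f = refl
sumTo-stirling1-shift (suc n) f = cong (+ suc n *_)
  (sumTo-shift-vanishing (suc n) (λ m → stirling1 (suc n) m * f m)
    refl (cong (_* f (suc (suc n))) (stirling1-above (n<1+n (suc n)))))

sumTo-stirling1-suc : ∀ n (f : Seq) →
  sumTo (suc n) (λ m → stirling1 (suc n) m * f m)
    ≡ sumTo n (λ m → stirling1 n m * f (suc m)) - + n * sumTo n (λ m → stirling1 n m * f m)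
sumTo-stirling1-suc n f = begin
  sumTo (suc n) (λ m → stirling1 (suc n) m * f m)
    ≡⟨ sumTo-shift n _ ⟩
  0ℤ ℤ.+ sumTo n (λ m → (stirling1 n m - + n * stirling1 n (suc m)) * f (suc m))
    ≡⟨ ℤP.+-identityˡ _ ⟩
  sumTo n (λ m → (stirling1 n m - + n * stirling1 n (suc m)) * f (suc m))
    ≡⟨ sumTo-cong n (λ m _ → distrib (stirling1 n m) (+ n) (stirling1 n (suc m)) (f (suc m))) ⟩
  sumTo n (λ m → stirling1 n m * f (suc m) - + n * (stirling1 n (suc m) * f (suc m)))
    ≡⟨ sumTo-- n _ _ ⟩
  sumTo n (λ m → stirling1 n m * f (suc m)) - sumTo n (λ m → + n * (stirling1 n (suc m) * f (suc m)))
    ≡⟨ cong (_-_ (sumTo n (λ m → stirling1 n m * f (suc m))))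
            (trans (sumTo-*ˡ n (+ n) _) (sumTo-stirling1-shift n f)) ⟩
  sumTo n (λ m → stirling1 n m * f (suc m)) - + n * sumTo n (λ m → stirling1 n m * f m) ∎
  where
    distrib : ∀ a c b x → (a - c * b) * x ≡ a * x - c * (b * x)
    distrib = solve-∀

sumTo-stirling1-falling : ∀ n (f : Seq) →
  sumTo (suc n) (λ m → stirling1 (suc n) m * f m) ≡ falling n (shift f) 0
sumTo-stirling1-falling zero    f = trans (ℤP.+-identityˡ _) (ℤP.*-identityˡ (f 1))
sumTo-stirling1-falling (suc n) f = begin
  sumTo (suc (suc n)) (λ m → stirling1 (suc (suc n)) m * f m)
    ≡⟨ sumTo-stirling1-suc (suc n) f ⟩
  sumTo (suc n) (λ m → stirling1 (suc n) m * f (suc m))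
    - + suc n * sumTo (suc n) (λ m → stirling1 (suc n) m * f m)
    ≡⟨ cong₂ (λ a b → a - + suc n * b) (sumTo-stirling1-falling n (shift f))
                                       (sumTo-stirling1-falling n f) ⟩
  falling n (shift (shift f)) 0 - + suc n * falling n (shift f) 0
    ≡⟨ cong (_- + suc n * falling n (shift f) 0) (falling-shift n (shift f) 0) ⟩
  falling n (shift f) 1 - + suc n * falling n (shift f) 0
    ≡⟨ split-off (falling n (shift f) 1) (falling n (shift f) 0) (+ n) ⟩
  falling (suc n) (shift f) 0 ∎
  where
    split-off : ∀ a b c → a - (1ℤ ℤ.+ c) * b ≡ (a - b) - c * b
    split-off = solve-∀

<ᵇ-true : ∀ {m n} → m < n → (m <ᵇ n) ≡ true
<ᵇ-true {zero}  {suc n} _         = refl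
<ᵇ-true {suc m} {suc n} (s≤s m<n) = <ᵇ-true m<n

<ᵇ-false : ∀ {m n} → n ≤ m → (m <ᵇ n) ≡ false
<ᵇ-false z≤n       = refl
<ᵇ-false (s≤s n≤m) = <ᵇ-false n≤m

≡ᵇ-refl : ∀ n → (n ≡ᵇ n) ≡ true
≡ᵇ-refl zero    = refl
≡ᵇ-refl (suc n) = ≡ᵇ-refl n

≡ᵇ-false : ∀ {m n} → m ≢ n → (m ≡ᵇ n) ≡ false
≡ᵇ-false {zero}  {zero}  m≢n = ⊥-elim (m≢n refl)
≡ᵇ-false {zero}  {suc n} _   = refl
≡ᵇ-false {suc m} {zero}  _   = refl
≡ᵇ-false {suc m} {suc n} m≢n = ≡ᵇ-false (λ m≡n → m≢n (cong suc m≡n))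

δ-refl : ∀ n → δ n n ≡ 1
δ-refl n rewrite ≡ᵇ-refl n = refl

δ-≢ : ∀ {m n} → m ≢ n → δ m n ≡ 0
δ-≢ m≢n rewrite ≡ᵇ-false m≢n = refl

rStirling2-diagonal : ∀ r m → rStirling2 r r m ≡ δ m r
rStirling2-diagonal zero    m = ℕ.+-identityʳ (δ m 0)
rStirling2-diagonal (suc n) m rewrite <ᵇ-false (≤-refl {n}) | ≡ᵇ-refl n = refl

rStirling2-n<r : ∀ {r n m} → suc n < r → rStirling2 r (suc n) m ≡ 0
rStirling2-n<r n<r rewrite <ᵇ-true n<r = refl

rStirling2-suc-zero : ∀ {r n} → r ≤ n → rStirling2 r (suc n) 0 ≡ 0
rStirling2-suc-zero r≤n rewrite <ᵇ-false (m≤n⇒m≤1+n r≤n) | ≡ᵇ-false (>⇒≢ (s≤s r≤n)) = refl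

rStirling2-suc-suc : ∀ {r n m} → r ≤ n →
  rStirling2 r (suc n) (suc m) ≡ suc m ℕ.* rStirling2 r n (suc m) ℕ.+ rStirling2 r n m
rStirling2-suc-suc r≤n rewrite <ᵇ-false (m≤n⇒m≤1+n r≤n) | ≡ᵇ-false (>⇒≢ (s≤s r≤n)) = refl

rStirling2-suc-suc-vanishing : ∀ {r n m} → r ≤ n →
  rStirling2 r n (suc m) ≡ 0 → rStirling2 r n m ≡ 0 → rStirling2 r (suc n) (suc m) ≡ 0
rStirling2-suc-suc-vanishing {m = m} r≤n S₁≡0 S₀≡0
  rewrite rStirling2-suc-suc {m = m} r≤n | S₁≡0 | S₀≡0 | ℕ.*-zeroʳ m = refl

rStirling2-below : ∀ {r m} n → m < r → rStirling2 r n m ≡ 0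
rStirling2-below {zero}  zero    ()
rStirling2-below {suc r} zero    _   = refl
rStirling2-below {r} {m} (suc n) m<r with <-cmp (suc n) r
... | tri< n<r _ _ = rStirling2-n<r {m = m} n<r
... | tri≈ _ refl _ = trans (rStirling2-diagonal (suc n) m) (δ-≢ (<⇒≢ m<r))
rStirling2-below {r} {zero}  (suc n) m<r | tri> _ _ (s≤s r≤n) = rStirling2-suc-zero r≤n
rStirling2-below {r} {suc m} (suc n) m<r | tri> _ _ (s≤s r≤n) =
  rStirling2-suc-suc-vanishing r≤n (rStirling2-below n m<r) (rStirling2-below n (<-trans (n<1+n m) m<r))

rStirling2-above : ∀ {r m} n → n < m → rStirling2 r n m ≡ 0
rStirling2-above {r} {suc m} zero    _ = ℕ.*-zeroʳ (δ r 0)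
rStirling2-above {r} {m}     (suc n) n<m with <-cmp (suc n) r
... | tri< n<r _ _ = rStirling2-n<r {m = m} n<r
... | tri≈ _ refl _ = trans (rStirling2-diagonal (suc n) m) (δ-≢ (>⇒≢ n<m))
rStirling2-above {r} {suc m} (suc n) (s≤s n<m) | tri> _ _ (s≤s r≤n) =
  rStirling2-suc-suc-vanishing r≤n (rStirling2-above n (m<n⇒m<1+n n<m)) (rStirling2-above n n<m)

sumTo-rStirling2-suc : ∀ {r N} → r ≤ N → (x : ℕ → ℤ) →
  sumTo (suc N) (λ m → + rStirling2 r (suc N) m * x m)
    ≡ sumTo N (λ m → + rStirling2 r N m * (x (suc m) ℤ.+ + m * x m))
sumTo-rStirling2-suc {r} {N} r≤N x = begin
  sumTo (suc N) (λ m → + rStirling2 r (suc N) m * x m)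
    ≡⟨ sumTo-shift N _ ⟩
  + rStirling2 r (suc N) 0 * x 0 ℤ.+ sumTo N (λ m → + rStirling2 r (suc N) (suc m) * x (suc m))
    ≡⟨ cong₂ ℤ._+_ (cong (λ s → + s * x 0) (rStirling2-suc-zero r≤N)) (sumTo-cong N (λ m _ → pascal m)) ⟩
  0ℤ ℤ.+ sumTo N (λ m → S m * x (suc m) ℤ.+ y (suc m))
    ≡⟨ trans (ℤP.+-identityˡ _) (sumTo-+ N _ _) ⟩
  sumTo N (λ m → S m * x (suc m)) ℤ.+ sumTo N (λ m → y (suc m))
    ≡⟨ cong (ℤ._+_ (sumTo N (λ m → S m * x (suc m)))) (sumTo-shift-vanishing N y refl y-top) ⟩
  sumTo N (λ m → S m * x (suc m)) ℤ.+ sumTo N y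
    ≡⟨ sumTo-+ N _ _ ⟨
  sumTo N (λ m → S m * x (suc m) ℤ.+ y m)
    ≡⟨ sumTo-cong N (λ m _ → trans (ℤP.*-distribˡ-+ (S m) (x (suc m)) (+ m * x m))
                                    (cong (ℤ._+_ (S m * x (suc m))) (swap (S m) (+ m) (x m)))) ⟨
  sumTo N (λ m → S m * (x (suc m) ℤ.+ + m * x m)) ∎
  where
    S : ℕ → ℤ
    S m = + rStirling2 r N m
    y : ℕ → ℤ
    y m = + m * (S m * x m)
    swap : ∀ a b c → a * (b * c) ≡ b * (a * c)
    swap = solve-∀
    y-top : y (suc N) ≡ 0ℤ
    y-top = trans (cong (λ s → + suc N * (+ s * x (suc N))) (rStirling2-above N (n<1+n N)))
                  (ℤP.*-zeroʳ (+ suc N))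
    pascal : ∀ m → + rStirling2 r (suc N) (suc m) * x (suc m) ≡ S m * x (suc m) ℤ.+ y (suc m)
    pascal m = begin
      + rStirling2 r (suc N) (suc m) * x (suc m)
        ≡⟨ cong (λ s → + s * x (suc m)) (rStirling2-suc-suc r≤N) ⟩
      (+ (suc m ℕ.* rStirling2 r N (suc m)) ℤ.+ S m) * x (suc m)
        ≡⟨ cong (λ s → (s ℤ.+ S m) * x (suc m)) (ℤP.pos-* (suc m) (rStirling2 r N (suc m))) ⟩
      (+ suc m * S (suc m) ℤ.+ S m) * x (suc m)
        ≡⟨ rearrange (+ suc m) (S (suc m)) (S m) (x (suc m)) ⟩
      S m * x (suc m) ℤ.+ y (suc m) ∎
      where
        rearrange : ∀ a s₁ s₀ z → (a * s₁ ℤ.+ s₀) * z ≡ s₀ * z ℤ.+ a * (s₁ * z)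
        rearrange = solve-∀

sumTo-rStirling2-falling : ∀ r j (g : Seq) p →
  sumTo (j + r) (λ m → + rStirling2 r (j + r) m * falling m g p) ≡ Δ^ j (falling r g) p
sumTo-rStirling2-falling r zero g p = begin
  sumTo r (λ m → + rStirling2 r r m * falling m g p)
    ≡⟨ sumTo-last r (λ m m<r → cong (λ s → + s * falling m g p) (rStirling2-below r m<r)) ⟩
  + rStirling2 r r r * falling r g p
    ≡⟨ cong (λ s → + s * falling r g p) (trans (rStirling2-diagonal r r) (δ-refl r)) ⟩
  1ℤ * falling r g p
    ≡⟨ ℤP.*-identityˡ _ ⟩
  falling r g p ∎
sumTo-rStirling2-falling r (suc j) g p = begin
  sumTo (suc N) (λ m → + rStirling2 r (suc N) m * falling m g p)
    ≡⟨ sumTo-rStirling2-suc (m≤n+m r j) (λ m → falling m g p) ⟩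
  sumTo N (λ m → S m * (falling (suc m) g p ℤ.+ + m * falling m g p))
    ≡⟨ sumTo-cong N (λ m _ → cong (S m *_) (Δ-falling m g p)) ⟨
  sumTo N (λ m → S m * Δ (falling m g) p)
    ≡⟨ Δ-sumTo N S (λ m → falling m g) p ⟨
  Δ (λ q → sumTo N (λ m → S m * falling m g q)) p
    ≡⟨ cong₂ _-_ (sumTo-rStirling2-falling r j g (suc p)) (sumTo-rStirling2-falling r j g p) ⟩
  Δ (Δ^ j (falling r g)) p
    ≡⟨ Δ^-Δ j (falling r g) p ⟨
  Δ^ (suc j) (falling r g) p ∎
  where
    N : ℕ
    N = j + r
    S : ℕ → ℤ
    S m = + rStirling2 r N m

theorem7 : (k n : ℕ) → k + 2 ≤ n →
  sumTo k (λ l → (+ rStirling2 (n ∸ k ∸ 1) (n ∸ 1) (n ∸ l ∸ 1)) * polyCauchyNeg (n ∸ l) k)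
    ≡ + 0
theorem7 k n k+2≤n with o , refl ← m≤n⇒∃[o]m+o≡n k+2≤n
  rewrite ℕ.+-assoc k 2 o | +-suc k (suc o) = begin
  sumTo k (λ l → + rStirling2 (suc N ∸ k ∸ 1) N (suc N ∸ l ∸ 1) * polyCauchyNeg (suc N ∸ l) k)
    ≡⟨ sumTo-cong k (λ l l≤k → cong₂ (λ r m → + rStirling2 r N (m ∸ 1) * polyCauchyNeg m k)
                                     r≡ (suc-∸ l≤k)) ⟩
  sumTo k (λ l → + rStirling2 (suc o) N (N ∸ l) * polyCauchyNeg (suc (N ∸ l)) k)
    ≡⟨ sumTo-reverse-drop k (suc o)
         (λ m m<r → cong (λ s → + s * polyCauchyNeg (suc m) k) (rStirling2-below N m<r)) ⟩
  sumTo N (λ m → + rStirling2 (suc o) N m * polyCauchyNeg (suc m) k)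
    ≡⟨ sumTo-cong N (λ m _ → cong (+ rStirling2 (suc o) N m *_) (sumTo-stirling1-falling m _)) ⟩
  sumTo N (λ m → + rStirling2 (suc o) N m * falling m g 0)
    ≡⟨ sumTo-rStirling2-falling (suc o) k g 0 ⟩
  Δ^ k (falling (suc o) g) 0
    ≡⟨ DegreeBelow-Δ^ (DegreeBelow-falling (DegreeBelow-^ k 2) o) 0 ⟩
  0ℤ ∎
  where
    N : ℕ
    N = k + suc o
    g : Seq
    g m = + (2 + m) ℕ.^ k
    suc-∸ : ∀ {l} → l ≤ k → suc N ∸ l ≡ suc (N ∸ l)
    suc-∸ l≤k = +-∸-assoc 1 (≤-trans l≤k (m≤m+n k (suc o)))
    r≡ : suc N ∸ k ∸ 1 ≡ suc o
    r≡ = trans (cong (_∸ 1) (suc-∸ ≤-refl)) (m+n∸m≡n k (suc o))
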